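{- Let $p$ be a prime, $N=p^2$, $w=e^{2\pi i/N}$ and $F=F_{p^2}=(w^{ij})_{i,j=0,\ldots,N-1}$. Then the set of matrices $A\in\widetilde{T}_FC_N$ whose first row and first column are zero (i.e. $A_{0j}=A_{i0}=0$ for all $i,j$) is exactly $$\{A\in M_N(\mathbb R)\mid \exists M\in M_p^\circ(\mathbb R)\text{ such that }A_{ij}=M_{\bar{i},\bar{j}}\text{ for all }i,j\},$$ where $\bar{i},\bar{j}\in\{0,\ldots,p-1\}$ denote the remainders of $i,j$ modulo $p$.
   Context: For a complex Hadamard matrix $H\in M_N(\mathbb C)$, $\widetilde{T}_HC_N$ denotes the real vector space of all $A\in M_N(\mathbb R)$ with $\sum_k H_{ik}\bar{H}_{jk}(A_{ik}-A_{jk})=0$ for all $i,j$. Indices run over $\{0,\ldots,N-1\}$. $M_p^\circ(\mathbb R)$ is the set of real $p\times p$ matrices (indices $0,\ldots,p-1$) whose first row and first column are zero. (In the paper this set is denoted $\widetilde{T}_FD_N$, the enveloping tangent space to the manifold of dephased complex Hadamard matrices.) -}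

module Defs where

open import Level using (Level; _⊔_) renaming (suc to lsuc)
open import Data.Nat using (ℕ; zero; suc; NonZero)
import Data.Nat as ℕ
open import Data.Nat.DivMod using (_mod_)
open import Data.Nat.Primality using (Prime; prime⇒nonZero)
open import Data.Fin using (Fin; toℕ) renaming (zero to fzero; suc to fsuc)
open import Data.Product using (∃; _×_; _,_)
open import Relation.Nullary using (¬_)
open import Relation.Binary.PropositionalEquality using (_≡_)
open import Algebra.Bundles using (CommutativeRing)

-- An abstract stand-in for ℂ: a field of characteristic zero equipped with an
-- involutive field automorphism ("complex conjugation").  "Real" elements are
-- the fixed points of the conjugation.  ℂ with z ↦ z̄ is an instance.
module RingOps {c ℓ : Level} (R : CommutativeRing c ℓ) where
  open CommutativeRing R
  natF : ℕ → Carrier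
  natF zero = 0#
  natF (suc n) = 1# + natF n
  infixr 8 _^_
  _^_ : Carrier → ℕ → Carrier
  x ^ zero = 1#
  x ^ suc n = x * (x ^ n)

record ConjField (c ℓ : Level) : Set (lsuc (c ⊔ ℓ)) where
  field
    commRing : CommutativeRing c ℓ
  open CommutativeRing commRing public
  open RingOps commRing public
  field
    0≉1       : ¬ (0# ≈ 1#)
    inverse   : ∀ x → ¬ (x ≈ 0#) → ∃ λ y → x * y ≈ 1#
    char0     : ∀ n → ¬ (natF (suc n) ≈ 0#)
    conj      : Carrier → Carrier
    conj-cong : ∀ {x y} → x ≈ y → conj x ≈ conj y
    conj-+    : ∀ x y → conj (x + y) ≈ conj x + conj y
    conj-*    : ∀ x y → conj (x * y) ≈ conj x * conj y
    conj-1    : conj 1# ≈ 1#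
    conj-inv  : ∀ x → conj (conj x) ≈ x

module _ {c ℓ : Level} (K : ConjField c ℓ) where
  open ConjField K

  sumF : (n : ℕ) → (Fin n → Carrier) → Carrier
  sumF zero f = 0#
  sumF (suc n) f = f fzero + sumF n (λ k → f (fsuc k))

  IsReal : Carrier → Set ℓ
  IsReal x = conj x ≈ x

  Mat : ℕ → Set c
  Mat n = Fin n → Fin n → Carrier

  RealMat : (n : ℕ) → Mat n → Set ℓ
  RealMat n A = ∀ i j → IsReal (A i j)

  PrimitiveRoot : ℕ → Carrier → Set ℓ
  PrimitiveRoot n w = (w ^ n ≈ 1#) × (∀ k → 0 ℕ.< k → k ℕ.< n → ¬ (w ^ k ≈ 1#))

  Fourier : (n : ℕ) → Carrier → Mat n
  Fourier n w i j = w ^ (toℕ i ℕ.* toℕ j)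

  InTangent : (n : ℕ) → Mat n → Mat n → Set ℓ
  InTangent n H A = ∀ i j →
    sumF n (λ k → H i k * conj (H j k) * (A i k - A j k)) ≈ 0#

  ZeroBorder : (n : ℕ) → Mat n → Set ℓ
  ZeroBorder n A = (∀ (i : Fin n) → toℕ i ≡ 0 → ∀ j → A i j ≈ 0#)
                 × (∀ (j : Fin n) → toℕ j ≡ 0 → ∀ i → A i j ≈ 0#)

bar : (p : ℕ) → Prime p → Fin (p ℕ.* p) → Fin p
bar p pr i = _mod_ (toℕ i) p {{prime⇒nonZero pr}}

module Submission where

-- Write Âᵢ(m) = Σₖ w^{km} A_{ik} for the discrete Fourier transform of row i.
-- Since F_{ik} conj(F_{jk}) = w^{k(i-j)}, the tangent equation for (i,j) says
-- Âᵢ(i-j) = Âⱼ(i-j); i.e. Âᵢ(m) is invariant under i ↦ i+m, hence under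
-- i ↦ i+tm for every t (row indices modulo N).
-- (⇒) If p ∤ m then m is a unit modulo N, so Âᵢ(m) = Â₀(m) = 0; by Fourier
-- inversion every row is p-periodic.  If p | m ≠ 0 then some multiple of m is
-- p modulo N, so Âᵢ₊ₚ(m) = Âᵢ(m): row i+p minus row i has its spectrum at 0,
-- hence is constant, hence zero because the first column is zero.
-- (⇐) If A_{ij} = M_{ī j̄} and ī ≠ j̄, the tangent sum splits into p blocks of
-- length p and factors through the geometric sum of the nontrivial p-th root
-- of unity w^{(i-j)p}, which vanishes.

open import Defs
open import Relation.Binary.Bundles using (Setoid)
open import Algebra.Bundles using (CommutativeRing)
open import Data.Nat as ℕ using (ℕ; suc)
open import Data.Nat.Primality using (Prime)

module Congruences where
  open import Data.Nat
  open import Data.Nat.Properties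
  open import Data.Nat.DivMod
  open import Data.Nat.Divisibility
  open import Data.Nat.Coprimality using (Coprime; coprime-Bézout; coprime-divisor)
  open import Data.Nat.GCD using (module Bézout)
  open import Data.Nat.Primality using (Prime; prime⇒irreducible; prime⇒nonZero)
  open import Data.Nat.Tactic.RingSolver using (solve)
  open import Data.Fin using (Fin; toℕ)
  open import Data.Fin.Properties using (toℕ-fromℕ<; fromℕ<-cong; toℕ-injective; toℕ<n)
  open import Data.List using (_∷_; [])
  open import Data.Product using (∃; _,_)
  open import Data.Sum using (inj₁; inj₂)
  open import Data.Empty using (⊥-elim)
  open import Relation.Nullary using (¬_)
  open import Relation.Binary.PropositionalEquality
  open ≡-Reasoning

  toℕ-mod : ∀ i n .{{_ : NonZero n}} → toℕ (i mod n) ≡ i % n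
  toℕ-mod i n = toℕ-fromℕ< _

  mod-congruent : ∀ i j {n} .{{_ : NonZero n}} → i % n ≡ j % n → i mod n ≡ j mod n
  mod-congruent i j e = fromℕ<-cong _ _ e _ _

  mod-toℕ : ∀ {n} .{{_ : NonZero n}} (x : Fin n) → toℕ x mod n ≡ x
  mod-toℕ {n} x = toℕ-injective (trans (toℕ-mod (toℕ x) n) (m<n⇒m%n≡m (toℕ<n x)))

  +-congruentˡ : ∀ i {a b n} .{{_ : NonZero n}} → a % n ≡ b % n → (i + a) % n ≡ (i + b) % n
  +-congruentˡ i {a} {b} {n} e = begin
    (i + a) % n               ≡⟨ %-distribˡ-+ i a n ⟩
    (i % n + a % n) % n       ≡⟨ cong (λ z → (i % n + z) % n) e ⟩
    (i % n + b % n) % n       ≡⟨ %-distribˡ-+ i b n ⟨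
    (i + b) % n               ∎

  *-congruentˡ : ∀ i {a b n} .{{_ : NonZero n}} → a % n ≡ b % n → (i * a) % n ≡ (i * b) % n
  *-congruentˡ i {a} {b} {n} e = begin
    (i * a) % n               ≡⟨ %-distribˡ-* i a n ⟩
    ((i % n) * (a % n)) % n   ≡⟨ cong (λ z → ((i % n) * z) % n) e ⟩
    ((i % n) * (b % n)) % n   ≡⟨ %-distribˡ-* i b n ⟨
    (i * b) % n               ∎

  %-absorbˡ : ∀ x y n .{{_ : NonZero n}} → (x % n + y) % n ≡ (x + y) % n
  %-absorbˡ x y n = begin
    (x % n + y) % n             ≡⟨ %-distribˡ-+ (x % n) y n ⟩
    (x % n % n + y % n) % n     ≡⟨ cong (λ z → (z + y % n) % n) (m%n%n≡m%n x n) ⟩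
    (x % n + y % n) % n         ≡⟨ %-distribˡ-+ x y n ⟨
    (x + y) % n                 ∎

  -- Modulo n = suc n₀ the number n₀ · j represents -j.  Hence (i+m) - i ≡ m,
  -- and i - j ≡ 0 modulo a divisor q of n forces i ≡ j modulo q.
  shift-frequency : ∀ n₀ i m →
    ((i + m) % suc n₀ + n₀ * (i % suc n₀)) % suc n₀ ≡ m % suc n₀
  shift-frequency n₀ i m = begin
    ((i + m) % n + n₀ * r) % n         ≡⟨ %-absorbˡ (i + m) (n₀ * r) n ⟩
    (i + m + n₀ * r) % n               ≡⟨ cong (λ z → (z + m + n₀ * r) % n) (m≡m%n+[m/n]*n i n) ⟩
    (r + q * n + m + n₀ * r) % n       ≡⟨ cong (_% n) (regroup r q) ⟩
    (m + (r + q) * n) % n              ≡⟨ [m+kn]%n≡m%n m (r + q) n ⟩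
    m % n                              ∎
    where
    n = suc n₀
    r = i % n
    q = i / n
    regroup : ∀ r q → r + q * suc n₀ + m + n₀ * r ≡ m + (r + q) * suc n₀
    regroup r q = solve (r ∷ q ∷ n₀ ∷ m ∷ [])

  difference-residue : ∀ {n₀ q} .{{_ : NonZero q}} → q ∣ suc n₀ → ∀ i j →
    (i + n₀ * j) % q ≡ 0 → i % q ≡ j % q
  difference-residue {n₀} {q} q∣n i j d≡0 = begin
    i % q                                ≡⟨ %-remove-+ʳ i (∣-trans q∣n (n∣m*n j)) ⟨
    (i + j * suc n₀) % q                 ≡⟨ cong (_% q) (solve (i ∷ j ∷ n₀ ∷ [])) ⟩
    ((i + n₀ * j) + j) % q               ≡⟨ %-distribˡ-+ (i + n₀ * j) j q ⟩
    ((i + n₀ * j) % q + j % q) % q       ≡⟨ cong (λ z → (z + j % q) % q) d≡0 ⟩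
    (j % q) % q                          ≡⟨ m%n%n≡m%n j q ⟩
    j % q                                ∎

  inverse-mod : ∀ {x} q .{{_ : NonZero q}} → Coprime x q → ∃ λ s → (s * x) % q ≡ 1 % q
  inverse-mod {x} q@(suc q′) c with coprime-Bézout c
  ... | Bézout.+- s y 1+yq≡sx = s , (begin
    (s * x) % q                  ≡⟨ cong (_% q) 1+yq≡sx ⟨
    (1 + y * q) % q              ≡⟨ [m+kn]%n≡m%n 1 y q ⟩
    1 % q                        ∎)
  ... | Bézout.-+ s y 1+sx≡yq = q′ * s , (begin
    (q′ * s * x) % q             ≡⟨ [m+n]%n≡m%n (q′ * s * x) q ⟨
    (q′ * s * x + q) % q         ≡⟨ cong (_% q) (begin
      q′ * s * x + suc q′          ≡⟨ solve (q′ ∷ s ∷ x ∷ []) ⟩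
      1 + q′ * (1 + s * x)         ≡⟨ cong (λ z → 1 + q′ * z) 1+sx≡yq ⟩
      1 + q′ * (y * q)             ≡⟨ cong suc (*-assoc q′ y q) ⟨
      1 + q′ * y * q               ∎) ⟩
    (1 + q′ * y * q) % q         ≡⟨ [m+kn]%n≡m%n 1 (q′ * y) q ⟩
    1 % q                        ∎)

  coprime⇒hits-every-residue : ∀ {x} q .{{_ : NonZero q}} → Coprime x q →
    ∀ i → ∃ λ t → (t * x) % q ≡ i % q
  coprime⇒hits-every-residue {x} q c i with inverse-mod q c
  ... | s , sx≡1 = i * s , (begin
    (i * s * x) % q              ≡⟨ cong (_% q) (*-assoc i s x) ⟩
    (i * (s * x)) % q            ≡⟨ *-congruentˡ i sx≡1 ⟩
    (i * 1) % q                  ≡⟨ cong (_% q) (*-identityʳ i) ⟩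
    i % q                        ∎)

  module _ {p : ℕ} (pr : Prime p) where
    private instance
      p≢0 : NonZero p
      p≢0 = prime⇒nonZero pr
      p²≢0 : NonZero (p * p)
      p²≢0 = m*n≢0 p p

    ¬∣⇒coprime : ∀ {m} → ¬ p ∣ m → Coprime m p
    ¬∣⇒coprime ¬p∣m (d∣m , d∣p) with prime⇒irreducible pr d∣p
    ... | inj₁ d≡1 = d≡1
    ... | inj₂ refl = ⊥-elim (¬p∣m d∣m)

    ¬∣⇒coprime-square : ∀ {m} → ¬ p ∣ m → Coprime m (p * p)
    ¬∣⇒coprime-square ¬p∣m {d} (d∣m , d∣p²) = ¬∣⇒coprime ¬p∣m (d∣m , d∣p)
      where
      d∣p : d ∣ p
      d∣p = coprime-divisor (λ (e∣d , e∣p) → ¬∣⇒coprime ¬p∣m (∣-trans e∣d d∣m , e∣p)) d∣p²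

    unit-hits-every-residue : ∀ {m} → ¬ p ∣ m → ∀ i → ∃ λ t → (t * m) % (p * p) ≡ i % (p * p)
    unit-hits-every-residue ¬p∣m = coprime⇒hits-every-residue (p * p) (¬∣⇒coprime-square ¬p∣m)

    multiple-hits-p : ∀ {u} → ¬ p ∣ u → ∃ λ t → (t * (u * p)) % (p * p) ≡ p % (p * p)
    multiple-hits-p {u} ¬p∣u with inverse-mod p (¬∣⇒coprime ¬p∣u)
    ... | t , tu≡1 = t , (begin
      (t * (u * p)) % (p * p)      ≡⟨ cong (_% (p * p)) (*-assoc t u p) ⟨
      (t * u * p) % (p * p)        ≡⟨ m%n*o≡m*o%[n*o] (t * u) p p ⟨
      (t * u) % p * p              ≡⟨ cong (_* p) tu≡1 ⟩
      1 % p * p                    ≡⟨ m%n*o≡m*o%[n*o] 1 p p ⟩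
      (1 * p) % (p * p)            ≡⟨ cong (_% (p * p)) (*-identityˡ p) ⟩
      p % (p * p)                  ∎)

    ¬∣-cofactor : ∀ {u} → 0 < u * p → u * p < p * p → ¬ p ∣ u
    ¬∣-cofactor {zero} () _ _
    ¬∣-cofactor {suc u} _ up<pp p∣u = <⇒≱ up<pp (*-monoˡ-≤ p (∣⇒≤ p∣u))

    p-times-nonresidue : ∀ d → d % p ≢ 0 → (p * d) % (p * p) ≢ 0
    p-times-nonresidue d d≢0 pd≡0 = d≢0 (m*n≡0⇒m≡0 (d % p) p (begin
      d % p * p                    ≡⟨ m%n*o≡m*o%[n*o] d p p ⟩
      (d * p) % (p * p)            ≡⟨ cong (_% (p * p)) (*-comm d p) ⟩
      (p * d) % (p * p)            ≡⟨ pd≡0 ⟩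
      0                            ∎))

module PeriodicReduction {c ℓ} (S : Setoid c ℓ) where
  open Setoid S
  open import Data.Nat
  open import Data.Nat.Properties using (+-identityʳ; ≤-<-trans; m≤m+n)
  open import Data.Nat.DivMod using (_%_; _/_; m≡m%n+[m/n]*n)
  open import Data.Nat.Tactic.RingSolver using (solve)
  open import Data.List using (_∷_; [])
  import Relation.Binary.PropositionalEquality as P
  open P using (_≡_)

  reduce-mod : ∀ p .{{_ : NonZero p}} n (f : ℕ → Carrier) →
    (∀ k → k + p < n → f (k + p) ≈ f k) → ∀ k → k < n → f k ≈ f (k % p)
  reduce-mod p n f shift k k<n =
    trans (reflexive (P.cong f k≡r+qp)) (unwind (k % p) (k / p) (P.subst (_< n) k≡r+qp k<n))
    where
    k≡r+qp = m≡m%n+[m/n]*n k p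
    unwind : ∀ r q → r + q * p < n → f (r + q * p) ≈ f r
    unwind r zero _ = reflexive (P.cong f (+-identityʳ r))
    unwind r (suc q) bound = trans (reflexive (P.cong f regroup))
      (trans (shift (r + q * p) bound′) (unwind r q (≤-<-trans (m≤m+n _ p) bound′)))
      where
      regroup : r + (p + q * p) ≡ r + q * p + p
      regroup = solve (r ∷ q ∷ p ∷ [])
      bound′ : r + q * p + p < n
      bound′ = P.subst (_< n) regroup bound

module SumsAndPowers {c ℓ} (R : CommutativeRing c ℓ) where
  open CommutativeRing R
  open RingOps R
  open import Data.Nat using (zero; z≤n; s≤s)
  import Data.Nat.Properties as ℕₚ
  open import Relation.Binary.PropositionalEquality as P using (_≡_; _≢_)
  open import Algebra.Properties.Ring ring using (-0#≈0#)
  open import Algebra.Properties.AbelianGroup +-abelianGroup using (⁻¹-∙-comm)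
  open import Algebra.Properties.CommutativeSemigroup +-commutativeSemigroup using (interchange)

  ∑ : ℕ → (ℕ → Carrier) → Carrier
  ∑ zero f = 0#
  ∑ (suc n) f = f 0 + ∑ n (λ k → f (suc k))

  ∑-cong : ∀ n {f g} → (∀ k → k ℕ.< n → f k ≈ g k) → ∑ n f ≈ ∑ n g
  ∑-cong zero f≈g = refl
  ∑-cong (suc n) f≈g = +-cong (f≈g 0 (s≤s z≤n)) (∑-cong n (λ k k<n → f≈g (suc k) (s≤s k<n)))

  ∑-zero : ∀ n {f} → (∀ k → k ℕ.< n → f k ≈ 0#) → ∑ n f ≈ 0#
  ∑-zero zero f≈0 = refl
  ∑-zero (suc n) f≈0 =
    trans (+-cong (f≈0 0 (s≤s z≤n)) (∑-zero n (λ k k<n → f≈0 (suc k) (s≤s k<n)))) (+-identityˡ 0#)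

  ∑-+ : ∀ n f g → ∑ n (λ k → f k + g k) ≈ ∑ n f + ∑ n g
  ∑-+ zero f g = sym (+-identityˡ 0#)
  ∑-+ (suc n) f g = trans (+-cong refl (∑-+ n _ _)) (interchange _ _ _ _)

  ∑-neg : ∀ n f → ∑ n (λ k → - f k) ≈ - ∑ n f
  ∑-neg zero f = sym -0#≈0#
  ∑-neg (suc n) f = trans (+-cong refl (∑-neg n _)) (⁻¹-∙-comm _ _)

  ∑-- : ∀ n f g → ∑ n (λ k → f k - g k) ≈ ∑ n f - ∑ n g
  ∑-- n f g = trans (∑-+ n f (λ k → - g k)) (+-cong refl (∑-neg n g))

  ∑-*ˡ : ∀ n x f → ∑ n (λ k → x * f k) ≈ x * ∑ n f
  ∑-*ˡ zero x f = sym (zeroʳ x)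
  ∑-*ˡ (suc n) x f = trans (+-cong refl (∑-*ˡ n x _)) (sym (distribˡ x _ _))

  ∑-*ʳ : ∀ n x f → ∑ n (λ k → f k * x) ≈ ∑ n f * x
  ∑-*ʳ n x f = trans (∑-cong n (λ k _ → *-comm (f k) x)) (trans (∑-*ˡ n x f) (*-comm x _))

  ∑-swap : ∀ m n (f : ℕ → ℕ → Carrier) →
    ∑ m (λ a → ∑ n (λ b → f a b)) ≈ ∑ n (λ b → ∑ m (λ a → f a b))
  ∑-swap zero n f = sym (∑-zero n (λ _ _ → refl))
  ∑-swap (suc m) n f = trans (+-cong refl (∑-swap m n (λ a b → f (suc a) b)))
                             (sym (∑-+ n (λ b → f 0 b) (λ b → ∑ m (λ a → f (suc a) b))))

  ∑-split : ∀ m n f → ∑ (m ℕ.+ n) f ≈ ∑ m f + ∑ n (λ k → f (m ℕ.+ k))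
  ∑-split zero n f = sym (+-identityˡ _)
  ∑-split (suc m) n f = trans (+-cong refl (∑-split m n (λ k → f (suc k)))) (sym (+-assoc _ _ _))

  ∑-blocks : ∀ q d f → ∑ (q ℕ.* d) f ≈ ∑ q (λ b → ∑ d (λ r → f (b ℕ.* d ℕ.+ r)))
  ∑-blocks zero d f = refl
  ∑-blocks (suc q) d f = trans (∑-split d (q ℕ.* d) f)
    (+-cong refl (trans (∑-blocks q d (λ k → f (d ℕ.+ k)))
      (∑-cong q (λ b _ → ∑-cong d (λ r _ → reflexive (P.cong f (P.sym (ℕₚ.+-assoc d (b ℕ.* d) r))))))))

  ∑-snoc : ∀ n f → ∑ (suc n) f ≈ ∑ n f + f n
  ∑-snoc zero f = +-comm _ _
  ∑-snoc (suc n) f = trans (+-cong refl (∑-snoc n (λ k → f (suc k)))) (sym (+-assoc _ _ _))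

  ∑-single : ∀ n k f → k ℕ.< n → (∀ l → l ℕ.< n → l ≢ k → f l ≈ 0#) → ∑ n f ≈ f k
  ∑-single (suc n) zero f _ others =
    trans (+-cong refl (∑-zero n (λ l l<n → others (suc l) (s≤s l<n) (λ ())))) (+-identityʳ _)
  ∑-single (suc n) (suc k) f (s≤s k<n) others =
    trans (+-cong (others 0 (s≤s z≤n) (λ ())) (∑-single n k (λ l → f (suc l)) k<n
                    (λ l l<n l≢k → others (suc l) (s≤s l<n) (λ e → l≢k (ℕₚ.suc-injective e)))))
          (+-identityˡ _)

  ∑-ones : ∀ n → ∑ n (λ _ → 1#) ≈ natF n
  ∑-ones zero = refl
  ∑-ones (suc n) = +-cong refl (∑-ones n)

  ^-congˡ : ∀ {x y} n → x ≈ y → x ^ n ≈ y ^ n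
  ^-congˡ zero _ = refl
  ^-congˡ (suc n) x≈y = *-cong x≈y (^-congˡ n x≈y)

  ^-congʳ : ∀ x {a b} → a ≡ b → x ^ a ≈ x ^ b
  ^-congʳ x a≡b = reflexive (P.cong (x ^_) a≡b)

  ^-+ : ∀ x a b → x ^ (a ℕ.+ b) ≈ x ^ a * x ^ b
  ^-+ x zero b = sym (*-identityˡ _)
  ^-+ x (suc a) b = trans (*-cong refl (^-+ x a b)) (sym (*-assoc _ _ _))

  ^-* : ∀ x a b → x ^ (a ℕ.* b) ≈ (x ^ b) ^ a
  ^-* x zero b = refl
  ^-* x (suc a) b = trans (^-+ x b (a ℕ.* b)) (*-cong refl (^-* x a b))

  1^ : ∀ n → 1# ^ n ≈ 1#
  1^ zero = refl
  1^ (suc n) = trans (*-identityˡ _) (1^ n)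

  *-zero-factorʳ : ∀ {x y} → y ≈ 0# → x * y ≈ 0#
  *-zero-factorʳ {x} y≈0 = trans (*-cong refl y≈0) (zeroʳ x)

module FieldLemmas {c ℓ} (K : ConjField c ℓ) where
  open ConjField K
  open SumsAndPowers commRing
  open import Data.Nat using (zero)
  open import Data.Product using (_,_)
  open import Relation.Nullary using (¬_)
  open import Relation.Binary.Reasoning.Setoid setoid
  open import Algebra.Properties.Ring ring using (-‿distribˡ-*; x[y-z]≈xy-xz)
  open import Algebra.Properties.AbelianGroup +-abelianGroup using (x∙y⁻¹≈ε⇒x≈y; x≈y⇒x∙y⁻¹≈ε; ∙-cancelˡ)

  conj-^ : ∀ x n → conj (x ^ n) ≈ conj x ^ n
  conj-^ x zero = conj-1
  conj-^ x (suc n) = trans (conj-* x (x ^ n)) (*-cong refl (conj-^ x n))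

  nonzero-factor : ∀ {y z} → ¬ (y ≈ 0#) → y * z ≈ 0# → z ≈ 0#
  nonzero-factor {y} {z} y≉0 yz≈0 with inverse y y≉0
  ... | y′ , yy′≈1 = begin
    z               ≈⟨ *-identityˡ z ⟨
    1# * z          ≈⟨ *-cong (trans (sym yy′≈1) (*-comm y y′)) refl ⟩
    (y′ * y) * z    ≈⟨ *-assoc y′ y z ⟩
    y′ * (y * z)    ≈⟨ *-zero-factorʳ yz≈0 ⟩
    0#              ∎

  cancelˡ : ∀ {y a b} → ¬ (y ≈ 0#) → y * a ≈ y * b → a ≈ b
  cancelˡ y≉0 ya≈yb =
    x∙y⁻¹≈ε⇒x≈y _ _ (nonzero-factor y≉0 (trans (x[y-z]≈xy-xz _ _ _) (x≈y⇒x∙y⁻¹≈ε ya≈yb)))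

  -- The powers of an n-th root of unity x ≠ 1 sum to zero: (x - 1) Σ x^b = 0.
  geometric-sum : ∀ n x → x ^ n ≈ 1# → ¬ (x ≈ 1#) → ∑ n (x ^_) ≈ 0#
  geometric-sum n x xⁿ≈1 x≉1 = nonzero-factor x-1≉0 (begin
    (x - 1#) * G           ≈⟨ distribʳ G x (- 1#) ⟩
    x * G + (- 1#) * G     ≈⟨ +-cong xG≈G (trans (sym (-‿distribˡ-* 1# G)) (-‿cong (*-identityˡ G))) ⟩
    G - G                  ≈⟨ -‿inverseʳ G ⟩
    0#                     ∎)
    where
    G = ∑ n (x ^_)
    x-1≉0 : ¬ (x - 1# ≈ 0#)
    x-1≉0 e = x≉1 (x∙y⁻¹≈ε⇒x≈y x 1# e)
    -- multiplying by x shifts the exponents by one, and xⁿ = 1 = x⁰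
    xG≈G : x * G ≈ G
    xG≈G = ∙-cancelˡ 1# (x * G) G (begin
      1# + x * G           ≈⟨ +-cong refl (∑-*ˡ n x (x ^_)) ⟨
      ∑ (suc n) (x ^_)     ≈⟨ ∑-snoc n (x ^_) ⟩
      G + x ^ n            ≈⟨ +-cong refl xⁿ≈1 ⟩
      G + 1#               ≈⟨ +-comm G 1# ⟩
      1# + G               ∎)

  -- If f is d-periodic and y = x^d is an e-th root of unity other than 1, then
  -- Σ_{t < e·d} x^t f(t) = (Σ_{b<e} y^b) · (Σ_{r<d} x^r f(r)) = 0.
  twisted-periodic-sum : ∀ e d x (f : ℕ → Carrier) → (x ^ d) ^ e ≈ 1# → ¬ (x ^ d ≈ 1#) →
    (∀ b r → f (b ℕ.* d ℕ.+ r) ≈ f r) → ∑ (e ℕ.* d) (λ t → x ^ t * f t) ≈ 0#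
  twisted-periodic-sum e d x f yᵉ≈1 y≉1 periodic = begin
    ∑ (e ℕ.* d) (λ t → x ^ t * f t)
      ≈⟨ ∑-blocks e d _ ⟩
    ∑ e (λ b → ∑ d (λ r → x ^ (b ℕ.* d ℕ.+ r) * f (b ℕ.* d ℕ.+ r)))
      ≈⟨ ∑-cong e (λ b _ → trans (∑-cong d (λ r _ → block-term b r)) (∑-*ˡ d (y ^ b) _)) ⟩
    ∑ e (λ b → y ^ b * ∑ d (λ r → x ^ r * f r))
      ≈⟨ ∑-*ʳ e _ (y ^_) ⟩
    ∑ e (y ^_) * ∑ d (λ r → x ^ r * f r)
      ≈⟨ *-cong (geometric-sum e y yᵉ≈1 y≉1) refl ⟩
    0# * ∑ d (λ r → x ^ r * f r)
      ≈⟨ zeroˡ _ ⟩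
    0# ∎
    where
    y = x ^ d
    block-term : ∀ b r → x ^ (b ℕ.* d ℕ.+ r) * f (b ℕ.* d ℕ.+ r) ≈ y ^ b * (x ^ r * f r)
    block-term b r = begin
      x ^ (b ℕ.* d ℕ.+ r) * f (b ℕ.* d ℕ.+ r)   ≈⟨ *-cong (^-+ x (b ℕ.* d) r) (periodic b r) ⟩
      x ^ (b ℕ.* d) * x ^ r * f r               ≈⟨ *-cong (*-cong (^-* x b d) refl) refl ⟩
      y ^ b * x ^ r * f r                       ≈⟨ *-assoc _ _ _ ⟩
      y ^ b * (x ^ r * f r)                     ∎

-- Fourier analysis for a primitive n-th root of unity w in K, where
-- n = suc n₀, so that w ^ n₀ is w⁻¹ and n₀ · j represents -j modulo n.
module RootsOfUnity {c ℓ} (K : ConjField c ℓ) (n₀ : ℕ) (w : ConjField.Carrier K)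
                    (prim : PrimitiveRoot K (suc n₀) w) where
  open ConjField K
  open SumsAndPowers commRing
  open FieldLemmas K using (cancelˡ; geometric-sum)
  open Congruences using (*-congruentˡ; difference-residue)
  open import Data.Nat using (zero; z≤n; s≤s)
  import Data.Nat.Properties as ℕₚ
  open import Data.Nat.DivMod using (_%_; _/_; m≡m%n+[m/n]*n; m%n<n; m<n⇒m%n≡m; [m+kn]%n≡m%n)
  open import Data.Nat.Divisibility using (_∣_; divides; _∣?_; ∣-refl)
  open import Data.Nat.Tactic.RingSolver using (solve)
  open import Data.List using (_∷_; [])
  open import Data.Product using (proj₁; proj₂)
  open import Relation.Nullary using (¬_; yes; no)
  import Relation.Binary.PropositionalEquality as P
  open P using (_≡_; _≢_)
  open import Relation.Binary.Reasoning.Setoid setoid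
  open import Algebra.Properties.Ring ring using (x[y-z]≈xy-xz)

  n : ℕ
  n = suc n₀

  w^[k*n]≈1 : ∀ k → w ^ (k ℕ.* n) ≈ 1#
  w^[k*n]≈1 k = trans (^-* w k n) (trans (^-congˡ k (proj₁ prim)) (1^ k))

  w^-mod : ∀ a → w ^ a ≈ w ^ (a % n)
  w^-mod a = begin
    w ^ a                                ≈⟨ ^-congʳ w (m≡m%n+[m/n]*n a n) ⟩
    w ^ (a % n ℕ.+ a / n ℕ.* n)          ≈⟨ ^-+ w (a % n) _ ⟩
    w ^ (a % n) * w ^ (a / n ℕ.* n)      ≈⟨ *-cong refl (w^[k*n]≈1 (a / n)) ⟩
    w ^ (a % n) * 1#                     ≈⟨ *-identityʳ _ ⟩
    w ^ (a % n)                          ∎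

  w^-congruent : ∀ a b → a % n ≡ b % n → w ^ a ≈ w ^ b
  w^-congruent a b e = trans (w^-mod a) (trans (^-congʳ w e) (sym (w^-mod b)))

  w^≉1 : ∀ a → a % n ≢ 0 → ¬ (w ^ a ≈ 1#)
  w^≉1 a a≢0 wᵃ≈1 =
    proj₂ prim (a % n) (ℕₚ.n≢0⇒n>0 a≢0) (m%n<n a n) (trans (sym (w^-mod a)) wᵃ≈1)

  w^-root : ∀ a → (w ^ a) ^ n ≈ 1#
  w^-root a = trans (sym (^-* w n a)) (trans (^-congʳ w (ℕₚ.*-comm n a)) (w^[k*n]≈1 a))

  transform : (ℕ → Carrier) → ℕ → Carrier
  transform f m = ∑ n (λ l → w ^ (l ℕ.* m) * f l)

  transform-cong : ∀ f g m → (∀ l → f l ≈ g l) → transform f m ≈ transform g m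
  transform-cong f g m f≈g =
    ∑-cong n {λ l → w ^ (l ℕ.* m) * f l} {λ l → w ^ (l ℕ.* m) * g l} (λ l _ → *-cong refl (f≈g l))

  transform-congruent : ∀ f m m′ → m % n ≡ m′ % n → transform f m ≈ transform f m′
  transform-congruent f m m′ e =
    ∑-cong n {λ l → w ^ (l ℕ.* m) * f l} {λ l → w ^ (l ℕ.* m′) * f l}
      (λ l _ → *-cong (w^-congruent (l ℕ.* m) (l ℕ.* m′) (*-congruentˡ l e)) refl)

  transform-- : ∀ f g m → transform (λ l → f l - g l) m ≈ transform f m - transform g m
  transform-- f g m = trans (∑-cong n (λ l _ → x[y-z]≈xy-xz (w ^ (l ℕ.* m)) (f l) (g l)))
                            (∑-- n (λ l → w ^ (l ℕ.* m) * f l) (λ l → w ^ (l ℕ.* m) * g l))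

  -- Fourier inversion  n · f(k) = Σ_{m<n} w^{-mk} f̂(m),  with w^{-mk} = w^{m·n₀k}:
  -- after exchanging the sums, Σ_m (w^{l-k})^m is n for l = k and 0 otherwise.
  inversion : ∀ f k → k ℕ.< n →
    natF n * f k ≈ ∑ n (λ m → w ^ (m ℕ.* (n₀ ℕ.* k)) * transform f m)
  inversion f k k<n = sym (begin
    ∑ n (λ m → w ^ (m ℕ.* (n₀ ℕ.* k)) * transform f m)
      ≈⟨ ∑-cong n (λ m _ → sym (∑-*ˡ n (w ^ (m ℕ.* (n₀ ℕ.* k))) (λ l → w ^ (l ℕ.* m) * f l))) ⟩
    ∑ n (λ m → ∑ n (λ l → w ^ (m ℕ.* (n₀ ℕ.* k)) * (w ^ (l ℕ.* m) * f l)))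
      ≈⟨ ∑-swap n n (λ m l → w ^ (m ℕ.* (n₀ ℕ.* k)) * (w ^ (l ℕ.* m) * f l)) ⟩
    ∑ n (λ l → ∑ n (λ m → w ^ (m ℕ.* (n₀ ℕ.* k)) * (w ^ (l ℕ.* m) * f l)))
      ≈⟨ ∑-cong n (λ l _ → trans (∑-cong n (λ m _ → regroup l m)) (∑-*ʳ n (f l) (ζ l ^_))) ⟩
    ∑ n (λ l → ∑ n (ζ l ^_) * f l)
      ≈⟨ ∑-single n k (λ l → ∑ n (ζ l ^_) * f l) k<n (λ l l<n l≢k →
           trans (*-cong (geometric-sum n (ζ l) (w^-root (l ℕ.+ n₀ ℕ.* k)) (ζ≉1 l l<n l≢k)) refl) (zeroˡ _)) ⟩
    ∑ n (ζ k ^_) * f k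
      ≈⟨ *-cong (trans (∑-cong n (λ m _ → trans (^-congˡ m ζₖ≈1) (1^ m))) (∑-ones n)) refl ⟩
    natF n * f k ∎)
    where
    -- ζ l = w^{l-k}
    ζ : ℕ → Carrier
    ζ l = w ^ (l ℕ.+ n₀ ℕ.* k)

    regroup : ∀ l m → w ^ (m ℕ.* (n₀ ℕ.* k)) * (w ^ (l ℕ.* m) * f l) ≈ ζ l ^ m * f l
    regroup l m = trans (sym (*-assoc _ _ _)) (*-cong (begin
      w ^ (m ℕ.* (n₀ ℕ.* k)) * w ^ (l ℕ.* m)      ≈⟨ ^-+ w (m ℕ.* (n₀ ℕ.* k)) (l ℕ.* m) ⟨
      w ^ (m ℕ.* (n₀ ℕ.* k) ℕ.+ l ℕ.* m)          ≈⟨ ^-congʳ w exponent ⟩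
      w ^ (m ℕ.* (l ℕ.+ n₀ ℕ.* k))                ≈⟨ ^-* w m (l ℕ.+ n₀ ℕ.* k) ⟩
      ζ l ^ m                                      ∎) refl)
      where
      exponent : m ℕ.* (n₀ ℕ.* k) ℕ.+ l ℕ.* m ≡ m ℕ.* (l ℕ.+ n₀ ℕ.* k)
      exponent = solve (m ∷ n₀ ∷ k ∷ l ∷ [])

    ζₖ≈1 : ζ k ≈ 1#
    ζₖ≈1 = trans (^-congʳ w exponent) (w^[k*n]≈1 k)
      where
      exponent : k ℕ.+ n₀ ℕ.* k ≡ k ℕ.* suc n₀
      exponent = solve (k ∷ n₀ ∷ [])

    ζ≉1 : ∀ l → l ℕ.< n → l ≢ k → ¬ (ζ l ≈ 1#)
    ζ≉1 l l<n l≢k = w^≉1 (l ℕ.+ n₀ ℕ.* k) (λ l-k≡0 → l≢k (P.trans (P.sym (m<n⇒m%n≡m l<n))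
      (P.trans (difference-residue {n₀} {n} ∣-refl l k l-k≡0) (m<n⇒m%n≡m k<n))))

  values-agree : ∀ f k k′ → k ℕ.< n → k′ ℕ.< n →
    (∀ m → m ℕ.< n → w ^ (m ℕ.* (n₀ ℕ.* k)) * transform f m
                    ≈ w ^ (m ℕ.* (n₀ ℕ.* k′)) * transform f m) →
    f k ≈ f k′
  values-agree f k k′ k<n k′<n terms≈ = cancelˡ (char0 n₀)
    (trans (inversion f k k<n) (trans (∑-cong n terms≈) (sym (inversion f k′ k′<n))))

  constant-if-spectrum-at-zero : ∀ f → (∀ m → 0 ℕ.< m → m ℕ.< n → transform f m ≈ 0#) →
    ∀ k → k ℕ.< n → f k ≈ f 0
  constant-if-spectrum-at-zero f off-zero k k<n = values-agree f k 0 k<n (s≤s z≤n) terms≈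
    where
    terms≈ : ∀ m → m ℕ.< n → w ^ (m ℕ.* (n₀ ℕ.* k)) * transform f m
                            ≈ w ^ (m ℕ.* (n₀ ℕ.* 0)) * transform f m
    terms≈ zero _ = refl
    terms≈ m@(suc _) m<n = trans (*-zero-factorʳ f̂ₘ≈0) (sym (*-zero-factorʳ f̂ₘ≈0))
      where f̂ₘ≈0 = off-zero m (s≤s z≤n) m<n

  -- For n = d · e, a function whose transform is supported on the multiples
  -- of e is d-periodic: at m = u·e the kernels at k + d and k differ by
  -- w^{u·n₀·de} = 1.
  periodic-if-spectrum-on-multiples : ∀ f d e → d ℕ.* e ≡ n →
    (∀ m → m ℕ.< n → ¬ e ∣ m → transform f m ≈ 0#) →
    ∀ k → k ℕ.+ d ℕ.< n → f (k ℕ.+ d) ≈ f k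
  periodic-if-spectrum-on-multiples f d e de≡n off-multiples k k+d<n =
    values-agree f (k ℕ.+ d) k k+d<n (ℕₚ.≤-<-trans (ℕₚ.m≤m+n k d) k+d<n) terms≈
    where
    terms≈ : ∀ m → m ℕ.< n → w ^ (m ℕ.* (n₀ ℕ.* (k ℕ.+ d))) * transform f m
                            ≈ w ^ (m ℕ.* (n₀ ℕ.* k)) * transform f m
    terms≈ m m<n with e ∣? m
    ... | no e∤m = trans (*-zero-factorʳ f̂ₘ≈0) (sym (*-zero-factorʳ f̂ₘ≈0))
      where f̂ₘ≈0 = off-multiples m m<n e∤m
    ... | yes (divides u m≡ue) =
      *-cong (w^-congruent (m ℕ.* (n₀ ℕ.* (k ℕ.+ d))) (m ℕ.* (n₀ ℕ.* k))
        (P.trans (P.cong (_% n) exponent) ([m+kn]%n≡m%n (m ℕ.* (n₀ ℕ.* k)) (u ℕ.* n₀) n))) refl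
      where
      expand : u ℕ.* e ℕ.* (n₀ ℕ.* (k ℕ.+ d))
             ≡ u ℕ.* e ℕ.* (n₀ ℕ.* k) ℕ.+ u ℕ.* n₀ ℕ.* (d ℕ.* e)
      expand = solve (u ∷ e ∷ n₀ ∷ k ∷ d ∷ [])
      exponent : m ℕ.* (n₀ ℕ.* (k ℕ.+ d)) ≡ m ℕ.* (n₀ ℕ.* k) ℕ.+ u ℕ.* n₀ ℕ.* n
      exponent = P.trans (P.cong (λ x → x ℕ.* (n₀ ℕ.* (k ℕ.+ d))) m≡ue) (P.trans expand
        (P.cong₂ (λ x y → x ℕ.* (n₀ ℕ.* k) ℕ.+ u ℕ.* n₀ ℕ.* y) (P.sym m≡ue) de≡n))

module FourierTangent {c ℓ} (K : ConjField c ℓ) (n₀ : ℕ) (w : ConjField.Carrier K)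
    (prim : PrimitiveRoot K (suc n₀) w)
    (conj-w : ConjField._≈_ K (ConjField.conj K w) (ConjField._^_ K w n₀)) where
  open ConjField K
  open SumsAndPowers commRing
  open FieldLemmas K using (conj-^)
  open RootsOfUnity K n₀ w prim
  open Congruences using (toℕ-mod; mod-congruent; mod-toℕ; shift-frequency)
  open import Data.Nat using (zero)
  import Data.Nat.Properties as ℕₚ
  open import Data.Nat.DivMod using (_%_; _mod_; m%n%n≡m%n)
  open import Data.Nat.Tactic.RingSolver using (solve)
  open import Data.List using (_∷_; [])
  open import Data.Fin using (Fin; toℕ) renaming (zero to fzero; suc to fsuc)
  import Relation.Binary.PropositionalEquality as P
  open P using (_≡_)
  open import Relation.Binary.Reasoning.Setoid setoid
  open import Algebra.Properties.AbelianGroup +-abelianGroup using (x∙y⁻¹≈ε⇒x≈y)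

  sumF≈∑ : ∀ m (f : Fin m → Carrier) (g : ℕ → Carrier) → (∀ x → f x ≈ g (toℕ x)) →
    sumF K m f ≈ ∑ m g
  sumF≈∑ zero f g f≈g = refl
  sumF≈∑ (suc m) f g f≈g =
    +-cong (f≈g fzero) (sumF≈∑ m (λ x → f (fsuc x)) (λ k → g (suc k)) (λ x → f≈g (fsuc x)))

  fourier-kernel : ∀ i j t → w ^ (i ℕ.* t) * conj (w ^ (j ℕ.* t)) ≈ w ^ (t ℕ.* (i ℕ.+ n₀ ℕ.* j))
  fourier-kernel i j t = begin
    w ^ (i ℕ.* t) * conj (w ^ (j ℕ.* t))     ≈⟨ *-cong refl (conj-^ w (j ℕ.* t)) ⟩
    w ^ (i ℕ.* t) * conj w ^ (j ℕ.* t)       ≈⟨ *-cong refl (^-congˡ (j ℕ.* t) conj-w) ⟩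
    w ^ (i ℕ.* t) * (w ^ n₀) ^ (j ℕ.* t)     ≈⟨ *-cong refl (^-* w (j ℕ.* t) n₀) ⟨
    w ^ (i ℕ.* t) * w ^ (j ℕ.* t ℕ.* n₀)     ≈⟨ ^-+ w (i ℕ.* t) (j ℕ.* t ℕ.* n₀) ⟨
    w ^ (i ℕ.* t ℕ.+ j ℕ.* t ℕ.* n₀)         ≈⟨ ^-congʳ w exponent ⟩
    w ^ (t ℕ.* (i ℕ.+ n₀ ℕ.* j))             ∎
    where
    exponent : i ℕ.* t ℕ.+ j ℕ.* t ℕ.* n₀ ≡ t ℕ.* (i ℕ.+ n₀ ℕ.* j)
    exponent = solve (i ∷ t ∷ j ∷ n₀ ∷ [])

  tangent-sum : ∀ (B : Mat K n) (b : ℕ → ℕ → Carrier) → (∀ x y → B x y ≈ b (toℕ x) (toℕ y)) →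
    ∀ I J → sumF K n (λ k → Fourier K n w I k * conj (Fourier K n w J k) * (B I k - B J k))
      ≈ ∑ n (λ t → w ^ (t ℕ.* (toℕ I ℕ.+ n₀ ℕ.* toℕ J)) * (b (toℕ I) t - b (toℕ J) t))
  tangent-sum B b B≈b I J =
    sumF≈∑ n _ (λ t → w ^ (t ℕ.* (toℕ I ℕ.+ n₀ ℕ.* toℕ J)) * (b (toℕ I) t - b (toℕ J) t))
      (λ x → *-cong (fourier-kernel (toℕ I) (toℕ J) (toℕ x)) (+-cong (B≈b I x) (-‿cong (B≈b J x))))

  entry : Mat K n → ℕ → ℕ → Carrier
  entry A i k = A (i mod n) (k mod n)

  entry-toℕ : ∀ A x y → A x y ≈ entry A (toℕ x) (toℕ y)
  entry-toℕ A x y = reflexive (P.sym (P.cong₂ A (mod-toℕ x) (mod-toℕ y)))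

  entry-congruent : ∀ A i i′ k k′ → i % n ≡ i′ % n → k % n ≡ k′ % n → entry A i k ≈ entry A i′ k′
  entry-congruent A i i′ k k′ i≡i′ k≡k′ =
    reflexive (P.cong₂ A (mod-congruent i i′ i≡i′) (mod-congruent k k′ k≡k′))

  row-transform : Mat K n → ℕ → ℕ → Carrier
  row-transform A i = transform (entry A i)

  row-transform-congruent : ∀ A i i′ m → i % n ≡ i′ % n → row-transform A i m ≈ row-transform A i′ m
  row-transform-congruent A i i′ m i≡i′ =
    transform-cong (entry A i) (entry A i′) m (λ l → entry-congruent A i i′ l l i≡i′ P.refl)

  module _ (A : Mat K n) (tangent : InTangent K n (Fourier K n w) A) where

    tangent⇒transforms-agree : ∀ I J →
      row-transform A (toℕ I) (toℕ I ℕ.+ n₀ ℕ.* toℕ J) ≈ row-transform A (toℕ J) (toℕ I ℕ.+ n₀ ℕ.* toℕ J)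
    tangent⇒transforms-agree I J = x∙y⁻¹≈ε⇒x≈y _ _ (begin
      row-transform A (toℕ I) d - row-transform A (toℕ J) d
        ≈⟨ transform-- (entry A (toℕ I)) (entry A (toℕ J)) d ⟨
      transform (λ t → entry A (toℕ I) t - entry A (toℕ J) t) d
        ≈⟨ tangent-sum A (entry A) (entry-toℕ A) I J ⟨
      sumF K n (λ k → Fourier K n w I k * conj (Fourier K n w J k) * (A I k - A J k))
        ≈⟨ tangent I J ⟩
      0# ∎)
      where d = toℕ I ℕ.+ n₀ ℕ.* toℕ J

    tangent⇒shift-invariant : ∀ i m → row-transform A (i ℕ.+ m) m ≈ row-transform A i m
    tangent⇒shift-invariant i m = begin
      row-transform A (i ℕ.+ m) m   ≈⟨ row-transform-congruent A (i ℕ.+ m) (toℕ I) m (P.sym i+m≡I) ⟩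
      row-transform A (toℕ I) m     ≈⟨ transform-congruent (entry A (toℕ I)) m d (P.sym d≡m) ⟩
      row-transform A (toℕ I) d     ≈⟨ tangent⇒transforms-agree I J ⟩
      row-transform A (toℕ J) d     ≈⟨ transform-congruent (entry A (toℕ J)) d m d≡m ⟩
      row-transform A (toℕ J) m     ≈⟨ row-transform-congruent A (toℕ J) i m J≡i ⟩
      row-transform A i m           ∎
      where
      I = (i ℕ.+ m) mod n
      J = i mod n
      d = toℕ I ℕ.+ n₀ ℕ.* toℕ J
      i+m≡I : toℕ I % n ≡ (i ℕ.+ m) % n
      i+m≡I = P.trans (P.cong (_% n) (toℕ-mod (i ℕ.+ m) n)) (m%n%n≡m%n (i ℕ.+ m) n)
      J≡i : toℕ J % n ≡ i % n
      J≡i = P.trans (P.cong (_% n) (toℕ-mod i n)) (m%n%n≡m%n i n)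
      d≡m : d % n ≡ m % n
      d≡m = P.trans (P.cong₂ (λ a b → (a ℕ.+ n₀ ℕ.* b) % n) (toℕ-mod (i ℕ.+ m) n) (toℕ-mod i n))
                    (shift-frequency n₀ i m)

    tangent⇒orbit-invariant : ∀ t i m → row-transform A (i ℕ.+ t ℕ.* m) m ≈ row-transform A i m
    tangent⇒orbit-invariant zero i m = reflexive (P.cong (λ j → row-transform A j m) (ℕₚ.+-identityʳ i))
    tangent⇒orbit-invariant (suc t) i m = begin
      row-transform A (i ℕ.+ suc t ℕ.* m) m    ≈⟨ reflexive (P.cong (λ j → row-transform A j m) regroup) ⟩
      row-transform A (i ℕ.+ t ℕ.* m ℕ.+ m) m  ≈⟨ tangent⇒shift-invariant (i ℕ.+ t ℕ.* m) m ⟩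
      row-transform A (i ℕ.+ t ℕ.* m) m        ≈⟨ tangent⇒orbit-invariant t i m ⟩
      row-transform A i m                      ∎
      where
      regroup : i ℕ.+ suc t ℕ.* m ≡ i ℕ.+ t ℕ.* m ℕ.+ m
      regroup = solve (i ∷ t ∷ m ∷ [])

module PrimeSquare {c ℓ} (K : ConjField c ℓ) (p′ : ℕ) (pr : Prime (suc p′))
    (w : ConjField.Carrier K) (prim : PrimitiveRoot K (suc p′ ℕ.* suc p′) w)
    (conj-w : ConjField._≈_ K (ConjField.conj K w) (ConjField._^_ K w (suc p′ ℕ.* suc p′ ℕ.∸ 1))) where
  p N n₀ : ℕ
  p = suc p′
  N = p ℕ.* p
  n₀ = N ℕ.∸ 1

  open ConjField K
  open SumsAndPowers commRing
  open FieldLemmas K using (twisted-periodic-sum)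
  open RootsOfUnity K n₀ w prim
  open FourierTangent K n₀ w prim conj-w
  open Congruences
  open PeriodicReduction setoid
  open import Data.Nat using (_<_; _≟_)
  import Data.Nat.Properties as ℕₚ
  open import Data.Nat.DivMod using (_%_; _mod_; m%n<n; [m+kn]%n≡m%n)
  open import Data.Nat.Divisibility using (_∣_; divides; _∣?_; n∣m*n)
  open import Data.Fin using (toℕ)
  open import Data.Fin.Properties using (toℕ<n)
  open import Data.Product using (_,_; proj₁; proj₂)
  open import Relation.Nullary using (¬_; yes; no)
  import Relation.Binary.PropositionalEquality as P
  open import Relation.Binary.Reasoning.Setoid setoid
  open import Algebra.Properties.AbelianGroup +-abelianGroup using (x∙y⁻¹≈ε⇒x≈y; x≈y⇒x∙y⁻¹≈ε)

  module Forward (A : Mat K N) (tangent : InTangent K N (Fourier K N w) A)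
                 (border : ZeroBorder K N A) where

    first-row-zero : ∀ k → entry A 0 k ≈ 0#
    first-row-zero k = proj₁ border (0 mod N) P.refl (k mod N)

    first-column-zero : ∀ i → entry A i 0 ≈ 0#
    first-column-zero i = proj₂ border (0 mod N) P.refl (i mod N)

    -- If p ∤ m then every row lies in the orbit i ↦ i + t·m of row 0, whose
    -- transform vanishes.
    transform-off-multiples : ∀ {m} → ¬ p ∣ m → ∀ i → row-transform A i m ≈ 0#
    transform-off-multiples {m} p∤m i with unit-hits-every-residue pr p∤m i
    ... | t , tm≡i = begin
      row-transform A i m           ≈⟨ row-transform-congruent A i (t ℕ.* m) m (P.sym tm≡i) ⟩
      row-transform A (t ℕ.* m) m   ≈⟨ tangent⇒orbit-invariant A tangent t 0 m ⟩
      row-transform A 0 m           ≈⟨ ∑-zero N {λ l → w ^ (l ℕ.* m) * entry A 0 l}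
                                              (λ l _ → *-zero-factorʳ (first-row-zero l)) ⟩
      0#                            ∎

    -- If p ∣ m with 0 < m < N then some multiple of m is p modulo N, so
    -- rows i and i + p have the same transform at m.
    transform-shift-by-p : ∀ {m} → 0 < m → m < N → p ∣ m → ∀ i →
      row-transform A (i ℕ.+ p) m ≈ row-transform A i m
    transform-shift-by-p {m} 0<m m<N (divides u m≡up) i
      with multiple-hits-p pr (¬∣-cofactor pr {u} (P.subst (0 <_) m≡up 0<m) (P.subst (_< N) m≡up m<N))
    ... | t , tup≡p = trans
      (row-transform-congruent A (i ℕ.+ p) (i ℕ.+ t ℕ.* m) m (+-congruentˡ i (P.sym tm≡p)))
      (tangent⇒orbit-invariant A tangent t i m)
      where
      tm≡p : (t ℕ.* m) % N P.≡ p % N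
      tm≡p = P.trans (P.cong (λ x → (t ℕ.* x) % N) m≡up) tup≡p

    -- By Fourier inversion each row is p-periodic ...
    rows-periodic : ∀ i k → k ℕ.+ p < N → entry A i (k ℕ.+ p) ≈ entry A i k
    rows-periodic i = periodic-if-spectrum-on-multiples (entry A i) p p P.refl
      (λ m _ p∤m → transform-off-multiples p∤m i)

    -- ... and row i + p minus row i, whose spectrum sits at 0, is constant,
    -- hence zero since the first column is zero.
    columns-periodic : ∀ i k → k < N → entry A (i ℕ.+ p) k ≈ entry A i k
    columns-periodic i k k<N = x∙y⁻¹≈ε⇒x≈y _ _ (begin
      difference k    ≈⟨ constant-if-spectrum-at-zero difference spectrum k k<N ⟩
      difference 0    ≈⟨ x≈y⇒x∙y⁻¹≈ε (trans (first-column-zero (i ℕ.+ p)) (sym (first-column-zero i))) ⟩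
      0#              ∎)
      where
      difference : ℕ → Carrier
      difference l = entry A (i ℕ.+ p) l - entry A i l
      transforms-agree : ∀ m → 0 < m → m < N → row-transform A (i ℕ.+ p) m ≈ row-transform A i m
      transforms-agree m 0<m m<N with p ∣? m
      ... | yes p∣m = transform-shift-by-p 0<m m<N p∣m i
      ... | no p∤m = trans (transform-off-multiples p∤m (i ℕ.+ p)) (sym (transform-off-multiples p∤m i))
      spectrum : ∀ m → 0 < m → m < N → transform difference m ≈ 0#
      spectrum m 0<m m<N = trans (transform-- (entry A (i ℕ.+ p)) (entry A i) m)
                                 (x≈y⇒x∙y⁻¹≈ε (transforms-agree m 0<m m<N))

    reduced : ∀ i j → i < N → j < N → entry A i j ≈ entry A (i % p) (j % p)
    reduced i j i<N j<N = trans
      (reduce-mod p N (entry A i) (rows-periodic i) j j<N)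
      (reduce-mod p N (λ i′ → entry A i′ (j % p)) (λ i′ _ → columns-periodic i′ (j % p) j%p<N) i i<N)
      where
      j%p<N = ℕₚ.<-≤-trans (m%n<n j p) (ℕₚ.m≤m*n p p)

    M : Mat K p
    M x y = entry A (toℕ x) (toℕ y)

    M-border : ZeroBorder K p M
    M-border = (λ x x≡0 y → proj₁ border (toℕ x mod N) (at-zero x≡0) (toℕ y mod N))
             , (λ y y≡0 x → proj₂ border (toℕ y mod N) (at-zero y≡0) (toℕ x mod N))
      where
      at-zero : ∀ {i} → i P.≡ 0 → toℕ (i mod N) P.≡ 0
      at-zero {i} i≡0 = P.trans (toℕ-mod i N) (P.cong (_% N) i≡0)

    A≈M : ∀ I J → A I J ≈ M (bar p pr I) (bar p pr J)
    A≈M I J = trans (entry-toℕ A I J) (trans (reduced (toℕ I) (toℕ J) (toℕ<n I) (toℕ<n J))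
      (reflexive (P.sym (P.cong₂ (entry A) (toℕ-mod (toℕ I) p) (toℕ-mod (toℕ J) p)))))

  module Backward (A : Mat K N) (M : Mat K p) (border : ZeroBorder K p M)
                  (A≈M : ∀ I J → A I J ≈ M (bar p pr I) (bar p pr J)) where

    lift : ℕ → ℕ → Carrier
    lift i k = M (i mod p) (k mod p)

    lift-periodic : ∀ i b r → lift i (b ℕ.* p ℕ.+ r) ≈ lift i r
    lift-periodic i b r = reflexive (P.cong (M (i mod p)) (mod-congruent (b ℕ.* p ℕ.+ r) r
      (P.trans (P.cong (_% p) (ℕₚ.+-comm (b ℕ.* p) r)) ([m+kn]%n≡m%n r b p))))

    -- For ī = j̄ every term vanishes; otherwise, with x = w^{i-j}, the sum is
    -- a twisted sum of a p-periodic function and x^p ≠ 1 = (x^p)^p.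
    tangent-sum-vanishes : ∀ i j →
      ∑ N (λ t → w ^ (t ℕ.* (i ℕ.+ n₀ ℕ.* j)) * (lift i t - lift j t)) ≈ 0#
    tangent-sum-vanishes i j with i % p ≟ j % p
    ... | yes i≡j = ∑-zero N {λ t → w ^ (t ℕ.* (i ℕ.+ n₀ ℕ.* j)) * (lift i t - lift j t)}
      (λ t _ → *-zero-factorʳ (x≈y⇒x∙y⁻¹≈ε (reflexive (P.cong (λ z → M z (t mod p)) (mod-congruent i j i≡j)))))
    ... | no i≢j = begin
      ∑ N (λ t → w ^ (t ℕ.* d) * f t)
        ≈⟨ ∑-cong N {λ t → w ^ (t ℕ.* d) * f t} {λ t → x ^ t * f t} (λ t _ → *-cong (^-* w t d) refl) ⟩
      ∑ N (λ t → x ^ t * f t)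
        ≈⟨ twisted-periodic-sum p p x f xᵖᵖ≈1 xᵖ≉1 f-periodic ⟩
      0# ∎
      where
      d = i ℕ.+ n₀ ℕ.* j
      x = w ^ d
      f : ℕ → Carrier
      f t = lift i t - lift j t
      f-periodic : ∀ b r → f (b ℕ.* p ℕ.+ r) ≈ f r
      f-periodic b r = +-cong (lift-periodic i b r) (-‿cong (lift-periodic j b r))
      d≢0 : d % p P.≢ 0
      d≢0 d≡0 = i≢j (difference-residue {n₀} {p} (n∣m*n p) i j d≡0)
      xᵖ≉1 : ¬ (x ^ p ≈ 1#)
      xᵖ≉1 xᵖ≈1 = w^≉1 (p ℕ.* d) (p-times-nonresidue pr d d≢0) (trans (^-* w p d) xᵖ≈1)
      xᵖᵖ≈1 : (x ^ p) ^ p ≈ 1#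
      xᵖᵖ≈1 = trans (sym (^-* x p p)) (w^-root d)

    tangent : InTangent K N (Fourier K N w) A
    tangent I J = trans (tangent-sum A lift A≈M I J) (tangent-sum-vanishes (toℕ I) (toℕ J))

    A-border : ZeroBorder K N A
    A-border = (λ I I≡0 J → trans (A≈M I J) (proj₁ border (bar p pr I) (at-zero I≡0) (bar p pr J)))
             , (λ J J≡0 I → trans (A≈M I J) (proj₂ border (bar p pr J) (at-zero J≡0) (bar p pr I)))
      where
      at-zero : ∀ {I} → toℕ I P.≡ 0 → toℕ (bar p pr I) P.≡ 0
      at-zero {I} I≡0 = P.trans (toℕ-mod (toℕ I) p) (P.cong (_% p) I≡0)


open import Level using (Level)
open import Data.Nat using (zero; _*_; _∸_; ≢-nonZero⁻¹)
open import Data.Nat.Primality using (prime⇒nonZero)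
open import Data.Product using (∃; _×_; _,_)
open import Data.Empty using (⊥-elim)
open import Function.Bundles using (_⇔_; mk⇔)
open import Relation.Binary.PropositionalEquality using (refl)
open ConjField using (Carrier; _≈_; _^_; conj)

proposition3p3 :
    ∀ {c ℓ : Level} (K : ConjField c ℓ) →
    (p : ℕ) (pr : Prime p) (w : Carrier K) →
    PrimitiveRoot K (p * p) w →
    _≈_ K (conj K w) (_^_ K w (p * p ∸ 1)) →
    (A : Mat K (p * p)) → RealMat K (p * p) A →
    (InTangent K (p * p) (Fourier K (p * p) w) A × ZeroBorder K (p * p) A)
      ⇔ (∃ λ (M : Mat K p) → RealMat K p M × ZeroBorder K p M ×
           (∀ i j → _≈_ K (A i j) (M (bar p pr i) (bar p pr j))))
-- 0 is not prime; for p = suc p′ the moduli p * p and p * p ∸ 1 compute to the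
-- form suc n₀ and n₀ expected by PrimeSquare.
proposition3p3 K zero pr = ⊥-elim (≢-nonZero⁻¹ 0 {{prime⇒nonZero pr}} refl)
proposition3p3 K (suc p′) pr w prim conj-w A A-real = mk⇔
  (λ (tangent , border) → let open Forward A tangent border in
     M , (λ x y → A-real _ _) , M-border , A≈M)
  (λ (M , _ , border , A≈M) → let open Backward A M border A≈M in
     tangent , A-border)
  where open PrimeSquare K p′ pr w prim conj-w
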